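{- For $n\ge1$, the number of partitions of type $B_n$ is $$\#\Pi_B(n)=\sum_{k=1}^n S(n,k)\,t_{k+1},$$ where $S(n,k)$ is the Stirling number of the second kind and $t_m$ is the number of involutions on $\{1,\dots,m\}$.
   Context: $[\pm n]=\{1,\dots,n,-1,\dots,-n\}$. A partition of type $B_n$ is a set partition $\pi$ of $[\pm n]$ such that whenever $B$ is a block of $\pi$, $-B=\{ -x:x\in B\}$ is also a block, and at most one block $B$ satisfies $B=-B$. $\Pi_B(n)$ is the set of partitions of type $B_n$. -}

module Defs where

open import Data.Nat using (ℕ; zero; suc; _+_; _*_)
open import Data.Bool using (Bool; true; false; _∧_; _∨_; not; T)
open import Data.Fin using (Fin; splitAt; join; _≟_)
open import Data.Sum using (_⊎_; inj₁; inj₂; swap)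
open import Data.Vec using (Vec; lookup)
open import Data.List using (List; allFin; applyUpTo)
open import Data.Nat.ListAction using (sum)
open import Data.Bool.ListAction using (all)
open import Data.Product using (Σ)
open import Relation.Nullary.Decidable using (⌊_⌋)

_⇒ᵇ_ : Bool → Bool → Bool
a ⇒ᵇ b = not a ∨ b

∀ᵇ : {m : ℕ} → (Fin m → Bool) → Bool
∀ᵇ {m} p = all p (allFin m)

-- The set [±n] = {1,…,n,-1,…,-n}, encoded as Fin (n + n):
-- the i-th element of the left summand (i : Fin n) is the number i+1,
-- the i-th element of the right summand is the number -(i+1).

PM : ℕ → Set
PM n = Fin (n + n)

neg : {n : ℕ} → PM n → PM n
neg {n} x = join n n (swap (splitAt n x))

-- A set partition of a finite set Fin m is represented by its
-- equivalence relation "x and y lie in the same block", stored as a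
-- Boolean m×m matrix (so distinct partitions are distinct matrices).

Rel : ℕ → Set
Rel m = Vec (Vec Bool m) m

_∼[_]_ : {m : ℕ} → Fin m → Rel m → Fin m → Bool
x ∼[ R ] y = lookup (lookup R x) y

isEquivᵇ : {m : ℕ} → Rel m → Bool
isEquivᵇ R =
  ∀ᵇ (λ x → x ∼[ R ] x) ∧
  ∀ᵇ (λ x → ∀ᵇ (λ y → (x ∼[ R ] y) ⇒ᵇ (y ∼[ R ] x))) ∧
  ∀ᵇ (λ x → ∀ᵇ (λ y → ∀ᵇ (λ z →
        ((x ∼[ R ] y) ∧ (y ∼[ R ] z)) ⇒ᵇ (x ∼[ R ] z))))

-- Type B conditions on a partition of [±n]:
--  * for every block B, -B is a block: x ∼ y implies -x ∼ -y;
--  * at most one block B with B = -B: the block of x satisfies B = -B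
--    iff x ∼ -x, and any two such x, y must lie in the same block.
isTypeBᵇ : {n : ℕ} → Rel (n + n) → Bool
isTypeBᵇ {n} R =
  isEquivᵇ R ∧
  ∀ᵇ (λ x → ∀ᵇ (λ y → (x ∼[ R ] y) ⇒ᵇ (neg {n} x ∼[ R ] neg {n} y))) ∧
  ∀ᵇ (λ x → ∀ᵇ (λ y →
        ((x ∼[ R ] neg {n} x) ∧ (y ∼[ R ] neg {n} y)) ⇒ᵇ (x ∼[ R ] y)))

PiB : ℕ → Set
PiB n = Σ (Rel (n + n)) (λ R → T (isTypeBᵇ {n} R))

Involution : ℕ → Set
Involution m = Σ (Vec (Fin m) m) (λ f → T (∀ᵇ (λ i → ⌊ lookup f (lookup f i) ≟ i ⌋)))

S : ℕ → ℕ → ℕ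
S zero    zero    = 1
S zero    (suc k) = 0
S (suc n) zero    = 0
S (suc n) (suc k) = suc k * S n (suc k) + S n k

sum1to : ℕ → (ℕ → ℕ) → ℕ
sum1to n f = sum (applyUpTo (λ i → f (suc i)) n)

module Submission where

-- Both sides of #Π_B(n) = Σ_{k=1}^{n} S(n,k)·t(k+1) equal extensions n 0, where
--   extensions 0 j = 1,  extensions (r+1) j = extensions r (j+1) + (2j+1)·extensions r j.
-- * Combinatorics: a type-B partition is built by placing ±1, …, ±n in turn; with
--   j pairs ±B of non-zero blocks open, +e opens a new pair or joins the zero block
--   or one of the 2j open blocks.  Formally we count the partitions consistent with
--   a labelling of the points decided so far (TypeB.count-completions).
-- * Arithmetic: with e_c(k) the involutions of k points some of which are matched
--   injectively to c colours, the Stirling recurrence turns the Stirling transform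
--   of e_{2j+1} into the recurrence of extensions, and e_1(k) = t(k+1).
-- * t is identified with the involution numbers by counting involutions as
--   extensions of partial involutions, one undecided point at a time.

open import Defs
open import Data.Nat using (ℕ; zero; suc; _+_; _*_; _<_; _≥_; s≤s; pred)
open import Data.Nat.Properties using (+-comm; +-assoc; *-zeroʳ; *-identityʳ; *-distribˡ-+; +-identityʳ; +-suc; ≤-refl; ≤-trans; n≤1+n)
import Data.Nat.Properties as ℕ
open import Data.Nat.Solver using (module +-*-Solver)
open import Data.Nat.ListAction using (sum)
open import Data.Bool using (Bool; true; false; _∧_; _∨_; not; T; if_then_else_)
open import Data.Bool.Properties using (T-irrelevant; ∧-identityʳ; T-≡; T-∧; T-∨)
import Data.Bool.Properties as Bool
open import Data.Fin using (Fin; zero; suc; _≟_; splitAt; join)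
open import Data.Fin.Properties using (+↔⊎; *↔×; 0↔⊥; 1↔⊤; any?; splitAt-join; join-splitAt)
import Data.Fin.Properties as Fin
open import Data.Fin.Permutation using (↔⇒≡)
open import Data.Sum using (_⊎_; inj₁; inj₂; swap)
open import Data.Sum.Properties using (swap-involutive)
open import Data.Sum.Function.Propositional using (_⊎-↔_)
open import Data.Product using (Σ; _×_; _,_; proj₁; proj₂)
open import Data.Product.Function.Dependent.Propositional using (Σ-↔)
open import Data.Maybe using (Maybe; just; nothing)
open import Data.Maybe.Properties using (just-injective)
open import Data.Unit using (⊤; tt)
open import Data.Empty using (⊥; ⊥-elim)
open import Data.List using (applyUpTo; allFin)
open import Data.List.Relation.Unary.All as All using (All)
open import Data.List.Relation.Unary.All.Properties using (all⁺; all⁻)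
open import Data.List.Membership.Propositional.Properties using (∈-allFin)
open import Data.Vec using (Vec; lookup; tabulate)
open import Data.Vec.Properties using (lookup∘tabulate; tabulate∘lookup; tabulate-cong)
import Data.Vec.Functional as Vector
open import Function using (_∘_; id)
open import Function.Bundles using (_↔_; Inverse; Equivalence; mk↔ₛ′)
open import Function.Properties.Inverse using (↔-sym; ↔-trans; ↔-refl)
import Function.Related.Propositional as Related
open import Relation.Binary.Definitions using (DecidableEquality)
open import Relation.Binary.PropositionalEquality using (_≡_; refl; sym; trans; cong; cong₂; subst; subst₂; module ≡-Reasoning)
open import Relation.Nullary using (Dec; yes; no; ¬_)
open import Relation.Nullary.Decidable using (⌊_⌋; toWitness; fromWitness; map′; _×-dec_; T?; ⌊⌋-map′)

open +-*-Solver using (solve; _:+_; _:*_; _:=_; con)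

-- The involution numbers t(m), by the recurrence t(m+2) = t(m+1) + (m+1)·t(m):
-- the last point is either fixed or exchanged with one of the m+1 others.
involutions : ℕ → ℕ
involutions zero          = 1
involutions (suc zero)    = 1
involutions (suc (suc m)) = involutions (suc m) + suc m * involutions m

-- extensions r j counts the ways to complete a type-B partition when j pairs
-- of blocks ±B with B ≠ -B are open and r pairs ±e are still to be placed:
-- +e opens a new pair, or joins the zero block or one of the 2j open blocks.
extensions : ℕ → ℕ → ℕ
extensions zero    j = 1
extensions (suc r) j = extensions r (suc j) + suc (j + j) * extensions r j

-- colouredInvolutions c k counts involutions on k points in which some points
-- are matched injectively with c colours (and then unpaired): colour c+1 is
-- either unused or matched with one of the k points.
colouredInvolutions : ℕ → ℕ → ℕ
colouredInvolutions zero    k       = involutions k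
colouredInvolutions (suc c) zero    = colouredInvolutions c zero
colouredInvolutions (suc c) (suc k) =
  colouredInvolutions c (suc k) + suc k * colouredInvolutions c k

coloured-empty : ∀ c → colouredInvolutions c 0 ≡ 1
coloured-empty zero    = refl
coloured-empty (suc c) = coloured-empty c

-- With a single colour, the colour acts as an extra point.
coloured-one : ∀ k → colouredInvolutions 1 k ≡ involutions (suc k)
coloured-one zero    = refl
coloured-one (suc k) = refl

-- A single point is either uncoloured or takes one of the c colours.
coloured-single : ∀ c → colouredInvolutions c 1 ≡ suc c
coloured-single zero = refl
coloured-single (suc c) rewrite coloured-single c | coloured-empty c = +-comm (suc c) 1

-- The ring identity behind the inductive step of coloured-shift.
private
  shift-algebra : ∀ k c a b b′ d f →
    suc k * b + b′ ≡ c * b + d → k * a + b ≡ c * a + f →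
    suc k * (b + suc k * a) + (b′ + suc (suc k) * b) ≡ suc c * (b + suc k * a) + (d + suc k * f)
  shift-algebra k c a b b′ d f hb ha = begin
      suc k * (b + suc k * a) + (b′ + suc (suc k) * b)
    ≡⟨ solve 5 (λ k a b b′ f → (con 1 :+ k) :* (b :+ (con 1 :+ k) :* a) :+ (b′ :+ (con 2 :+ k) :* b)
          := ((con 1 :+ k) :* b :+ b′) :+ (con 1 :+ k) :* (k :* a :+ b) :+ (con 1 :+ k) :* a :+ b) refl k a b b′ f ⟩
      (suc k * b + b′) + suc k * (k * a + b) + suc k * a + b
    ≡⟨ cong₂ (λ u v → u + suc k * v + suc k * a + b) hb ha ⟩
      (c * b + d) + suc k * (c * a + f) + suc k * a + b
    ≡⟨ solve 6 (λ k a b d f c → (c :* b :+ d) :+ (con 1 :+ k) :* (c :* a :+ f) :+ (con 1 :+ k) :* a :+ b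
          := (con 1 :+ c) :* (b :+ (con 1 :+ k) :* a) :+ (d :+ (con 1 :+ k) :* f)) refl k a b d f c ⟩
      suc c * (b + suc k * a) + (d + suc k * f) ∎
    where open ≡-Reasoning

-- The operator g ↦ (k ↦ k·g(k) + g(k+1)), which the Stirling recurrence
-- produces, acts on e_c = colouredInvolutions c as e_c ↦ c·e_c + e_{c+2}.
coloured-shift : ∀ c k →
  k * colouredInvolutions c k + colouredInvolutions c (suc k)
    ≡ c * colouredInvolutions c k + colouredInvolutions (suc (suc c)) k
coloured-shift c zero rewrite coloured-empty c | coloured-single c =
  sym (trans (+-comm (c * 1) 1) (cong suc (*-identityʳ c)))
coloured-shift zero (suc k) rewrite coloured-one k =
  +-comm (suc k * involutions (suc k)) (involutions (suc (suc k)))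
coloured-shift (suc c) (suc k) =
  shift-algebra k c (e c k) (e c (suc k)) (e c (suc (suc k))) (e (suc (suc c)) (suc k)) (e (suc (suc c)) k)
                (coloured-shift c (suc k)) (coloured-shift c k)
  where
  e : ℕ → ℕ → ℕ
  e = colouredInvolutions

Σ< : ℕ → (ℕ → ℕ) → ℕ
Σ< K f = sum (applyUpTo f K)

Σ<-cong : ∀ K {f g : ℕ → ℕ} → (∀ k → f k ≡ g k) → Σ< K f ≡ Σ< K g
Σ<-cong zero    eq = refl
Σ<-cong (suc K) eq = cong₂ _+_ (eq 0) (Σ<-cong K (λ k → eq (suc k)))

Σ<-+ : ∀ K (f g : ℕ → ℕ) → Σ< K (λ k → f k + g k) ≡ Σ< K f + Σ< K g
Σ<-+ zero    f g = refl
Σ<-+ (suc K) f g rewrite Σ<-+ K (λ k → f (suc k)) (λ k → g (suc k)) =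
  solve 4 (λ a b c d → (a :+ b) :+ (c :+ d) := (a :+ c) :+ (b :+ d)) refl
          (f 0) (g 0) (Σ< K (λ k → f (suc k))) (Σ< K (λ k → g (suc k)))

Σ<-* : ∀ K c (f : ℕ → ℕ) → Σ< K (λ k → c * f k) ≡ c * Σ< K f
Σ<-* zero    c f = sym (*-zeroʳ c)
Σ<-* (suc K) c f rewrite Σ<-* K c (λ k → f (suc k)) = sym (*-distribˡ-+ c (f 0) _)

Σ<-last : ∀ K f → Σ< (suc K) f ≡ Σ< K f + f K
Σ<-last zero    f = +-comm (f 0) 0
Σ<-last (suc K) f rewrite Σ<-last K (λ k → f (suc k)) = sym (+-assoc (f 0) _ _)

S-vanishes : ∀ n k → n < k → S n k ≡ 0
S-vanishes zero    (suc k) _         = refl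
S-vanishes (suc n) (suc k) (s≤s n<k)
  rewrite S-vanishes n (suc k) (≤-trans n<k (n≤1+n k)) | S-vanishes n k n<k =
  trans (+-identityʳ _) (*-zeroʳ (suc k))

stirling : ℕ → (ℕ → ℕ) → ℕ
stirling n g = Σ< (suc n) (λ k → S n k * g k)

-- The recurrence S(n+1,k+1) = (k+1)·S(n,k+1) + S(n,k), transported to the
-- transform: one step in n applies the operator g ↦ (k ↦ k·g(k) + g(k+1)).
stirling-step : ∀ n g → stirling (suc n) g ≡ stirling n (λ k → k * g k + g (suc k))
stirling-step n g = begin
    Σ< (suc n) (λ k → (suc k * S n (suc k) + S n k) * g (suc k))
  ≡⟨ Σ<-cong (suc n) (λ k → solve 4 (λ k a b c → ((con 1 :+ k) :* a :+ b) :* c := (con 1 :+ k) :* a :* c :+ b :* c)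
                               refl k (S n (suc k)) (S n k) (g (suc k))) ⟩
    Σ< (suc n) (λ k → u (suc k) + S n k * g (suc k))
  ≡⟨ Σ<-+ (suc n) (λ k → u (suc k)) (λ k → S n k * g (suc k)) ⟩
    Σ< (suc n) (λ k → u (suc k)) + Σ< (suc n) (λ k → S n k * g (suc k))
  ≡⟨ cong (_+ Σ< (suc n) (λ k → S n k * g (suc k))) shift ⟩
    Σ< (suc n) u + Σ< (suc n) (λ k → S n k * g (suc k))
  ≡⟨ sym (Σ<-+ (suc n) u (λ k → S n k * g (suc k))) ⟩
    Σ< (suc n) (λ k → u k + S n k * g (suc k))
  ≡⟨ Σ<-cong (suc n) (λ k → solve 4 (λ k a b c → k :* a :* b :+ a :* c := a :* (k :* b :+ c))
                               refl k (S n k) (g k) (g (suc k))) ⟩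
    stirling n (λ k → k * g k + g (suc k)) ∎
  where
  open ≡-Reasoning
  u : ℕ → ℕ
  u k = k * S n k * g k
  -- Σ_{k ≤ n} u(k+1) = Σ_{k ≤ n} u(k), as u(0) = 0 and u(n+1) = 0.
  shift : Σ< (suc n) (λ k → u (suc k)) ≡ Σ< (suc n) u
  shift = begin
      Σ< (suc (suc n)) u
    ≡⟨ Σ<-last (suc n) u ⟩
      Σ< (suc n) u + (suc n * S n (suc n)) * g (suc n)
    ≡⟨ cong (λ s → Σ< (suc n) u + suc n * s * g (suc n)) (S-vanishes n (suc n) ≤-refl) ⟩
      Σ< (suc n) u + suc n * 0 * g (suc n)
    ≡⟨ cong (λ z → Σ< (suc n) u + z * g (suc n)) (*-zeroʳ (suc n)) ⟩
      Σ< (suc n) u + 0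
    ≡⟨ +-identityʳ _ ⟩
      Σ< (suc n) u ∎

stirling-linear : ∀ n c (f g : ℕ → ℕ) → stirling n (λ k → c * f k + g k) ≡ c * stirling n f + stirling n g
stirling-linear n c f g = begin
    Σ< (suc n) (λ k → S n k * (c * f k + g k))
  ≡⟨ Σ<-cong (suc n) (λ k → solve 4 (λ s c a b → s :* (c :* a :+ b) := c :* (s :* a) :+ s :* b)
                               refl (S n k) c (f k) (g k)) ⟩
    Σ< (suc n) (λ k → c * (S n k * f k) + S n k * g k)
  ≡⟨ Σ<-+ (suc n) (λ k → c * (S n k * f k)) (λ k → S n k * g k) ⟩
    Σ< (suc n) (λ k → c * (S n k * f k)) + stirling n g
  ≡⟨ cong (_+ stirling n g) (Σ<-* (suc n) c (λ k → S n k * f k)) ⟩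
    c * stirling n f + stirling n g ∎
  where open ≡-Reasoning

-- The Stirling transform of e_{2j+1} is extensions · j: by coloured-shift it
-- satisfies the same recurrence in n.
stirling-coloured : ∀ n j → stirling n (colouredInvolutions (suc (j + j))) ≡ extensions n j
stirling-coloured zero j rewrite coloured-empty (suc (j + j)) = refl
stirling-coloured (suc n) j = begin
    stirling (suc n) (e c)
  ≡⟨ stirling-step n (e c) ⟩
    stirling n (λ k → k * e c k + e c (suc k))
  ≡⟨ Σ<-cong (suc n) (λ k → cong (S n k *_) (coloured-shift c k)) ⟩
    stirling n (λ k → c * e c k + e (suc (suc c)) k)
  ≡⟨ stirling-linear n c (e c) (e (suc (suc c))) ⟩
    c * stirling n (e c) + stirling n (e (suc (suc c)))
  ≡⟨ cong₂ (λ a b → c * a + stirling n (e (suc (suc b)))) (stirling-coloured n j) (sym (+-suc j j)) ⟩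
    c * extensions n j + stirling n (e (suc (suc j + suc j)))
  ≡⟨ cong (c * extensions n j +_) (stirling-coloured n (suc j)) ⟩
    c * extensions n j + extensions n (suc j)
  ≡⟨ +-comm (c * extensions n j) _ ⟩
    extensions (suc n) j ∎
  where
  open ≡-Reasoning
  c : ℕ
  c = suc (j + j)
  e : ℕ → ℕ → ℕ
  e = colouredInvolutions

-- The arithmetic half of the theorem: Σ_{k=1}^{n} S(n,k)·t(k+1) = extensions n 0 for
-- n ≥ 1 (the term k = 0 of the transform vanishes, and e_1(k) = t(k+1) by definition).
stirling-involutions : ∀ n → sum1to (suc n) (λ k → S (suc n) k * involutions (suc k)) ≡ extensions (suc n) 0
stirling-involutions n = stirling-coloured (suc n) 0

T-ext : ∀ {a b} → (T a → T b) → (T b → T a) → a ≡ b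
T-ext {false} {false} _ _ = refl
T-ext {false} {true}  _ g = ⊥-elim (g tt)
T-ext {true}  {false} f _ = ⊥-elim (f tt)
T-ext {true}  {true}  _ _ = refl

T-true : ∀ {a} → T a → a ≡ true
T-true {a} = Equivalence.to (T-≡ {a})

T-from-≡ : ∀ {a} → a ≡ true → T a
T-from-≡ {a} = Equivalence.from (T-≡ {a})

T-false : ∀ {a} → T a → a ≡ false → ⊥
T-false {true} _ ()

¬T-false : ∀ {a} → (T a → ⊥) → a ≡ false
¬T-false {false} _ = refl
¬T-false {true}  n = ⊥-elim (n tt)

⇒ᵇ-intro : ∀ {a b} → (T a → T b) → T (a ⇒ᵇ b)
⇒ᵇ-intro {false} _ = tt
⇒ᵇ-intro {true}  f = f tt

⇒ᵇ-elim : ∀ {a b} → T (a ⇒ᵇ b) → T a → T b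
⇒ᵇ-elim {true} p _ = p

∧-intro : ∀ {a b} → T a → T b → T (a ∧ b)
∧-intro {a} {b} p q = Equivalence.from (T-∧ {a} {b}) (p , q)

∧-left : ∀ {a b} → T (a ∧ b) → T a
∧-left {a} {b} t = proj₁ (Equivalence.to (T-∧ {a} {b}) t)

∧-right : ∀ {a b} → T (a ∧ b) → T b
∧-right {a} {b} t = proj₂ (Equivalence.to (T-∧ {a} {b}) t)

∨-left : ∀ {a b} → T a → T (a ∨ b)
∨-left {a} {b} p = Equivalence.from (T-∨ {a} {b}) (inj₁ p)

∨-right : ∀ {a b} → T b → T (a ∨ b)
∨-right {a} {b} q = Equivalence.from (T-∨ {a} {b}) (inj₂ q)

∨-cases : ∀ {a b} → T (a ∨ b) → T a ⊎ T b
∨-cases {a} {b} = Equivalence.to (T-∨ {a} {b})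

not-intro : ∀ {a} → (T a → ⊥) → T (not a)
not-intro {false} _ = tt
not-intro {true}  n = n tt

not-elim : ∀ {a} → T (not a) → T a → ⊥
not-elim {false} _ ()

not-∨ : ∀ a b → not (a ∨ b) ≡ not a ∧ not b
not-∨ false _ = refl
not-∨ true  _ = refl

∀ᵇ-intro : ∀ {m} {p : Fin m → Bool} → (∀ i → T (p i)) → T (∀ᵇ p)
∀ᵇ-intro {p = p} h = all⁻ p {allFin _} (All.tabulate (λ {i} _ → h i))

∀ᵇ-elim : ∀ {m} {p : Fin m → Bool} → T (∀ᵇ p) → ∀ i → T (p i)
∀ᵇ-elim {p = p} t i = All.lookup (all⁺ p (allFin _) t) (∈-allFin i)

Σ-T-≡ : ∀ {A : Set} {p : A → Bool} {x y : Σ A (λ a → T (p a))} → proj₁ x ≡ proj₁ y → x ≡ y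
Σ-T-≡ {x = a , s} {y = .a , s′} refl = cong (a ,_) (T-irrelevant s s′)

Vec-ext : ∀ {A : Set} {n} (v w : Vec A n) → (∀ i → lookup v i ≡ lookup w i) → v ≡ w
Vec-ext v w h = trans (sym (tabulate∘lookup v)) (trans (tabulate-cong h) (tabulate∘lookup w))

count : ∀ {m} → (Fin m → Bool) → ℕ
count {zero}  p = 0
count {suc m} p = (if p zero then 1 else 0) + count (p ∘ suc)

count-cong : ∀ {m} {p q : Fin m → Bool} → (∀ x → p x ≡ q x) → count p ≡ count q
count-cong {zero}  h = refl
count-cong {suc m} h rewrite h zero = cong (_ +_) (count-cong (h ∘ suc))

T↔Fin : ∀ b → T b ↔ Fin (if b then 1 else 0)
T↔Fin true  = ↔-sym 1↔⊤
T↔Fin false = ↔-sym 0↔⊥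

Σ-Fin-suc : ∀ {m} (P : Fin (suc m) → Set) → Σ (Fin (suc m)) P ↔ (P zero ⊎ Σ (Fin m) (P ∘ suc))
Σ-Fin-suc P = mk↔ₛ′ to from (λ { (inj₁ _) → refl ; (inj₂ _) → refl })
                            (λ { (zero , _) → refl ; (suc _ , _) → refl })
  where
  to : Σ _ P → _
  to (zero  , q) = inj₁ q
  to (suc i , q) = inj₂ (i , q)
  from : _ → Σ _ P
  from (inj₁ q)       = zero , q
  from (inj₂ (i , q)) = suc i , q

count↔ : ∀ {m} (p : Fin m → Bool) → Σ (Fin m) (λ i → T (p i)) ↔ Fin (count p)
count↔ {zero}  p = mk↔ₛ′ (λ ()) (λ ()) (λ ()) (λ ())
count↔ {suc m} p = begin
    Σ (Fin (suc m)) (λ i → T (p i))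
  ↔⟨ Σ-Fin-suc (λ i → T (p i)) ⟩
    (T (p zero) ⊎ Σ (Fin m) (λ i → T (p (suc i))))
  ↔⟨ T↔Fin (p zero) ⊎-↔ count↔ (p ∘ suc) ⟩
    (Fin (if p zero then 1 else 0) ⊎ Fin (count (p ∘ suc)))
  ↔⟨ ↔-sym +↔⊎ ⟩
    Fin (count p) ∎
  where open Related.EquationalReasoning

count-zero : ∀ {m} (p : Fin m → Bool) → count p ≡ 0 → ∀ x → T (p x) → ⊥
count-zero p c x px with subst Fin c (Inverse.to (count↔ p) (x , px))
... | ()

count-suc : ∀ {m k} (p : Fin m → Bool) → count p ≡ suc k → Σ (Fin m) (λ x → T (p x))
count-suc p c = Inverse.from (count↔ p) (subst Fin (sym c) zero)

count-remove : ∀ {m} (p : Fin m → Bool) e → T (p e) →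
  count p ≡ suc (count (λ x → p x ∧ not ⌊ x ≟ e ⌋))
count-remove {suc m} p zero pe rewrite T-true pe =
  cong suc (count-cong (λ x → sym (∧-identityʳ (p (suc x)))))
count-remove {suc m} p (suc e) pe = begin
    (if p zero then 1 else 0) + count (p ∘ suc)
  ≡⟨ cong₂ _+_ (cong (λ b → if b then 1 else 0) (sym (∧-identityʳ (p zero)))) (count-remove (p ∘ suc) e pe) ⟩
    (if p zero ∧ true then 1 else 0) + suc (count (λ x → p (suc x) ∧ not ⌊ x ≟ e ⌋))
  ≡⟨ +-suc _ _ ⟩
    suc ((if p zero ∧ true then 1 else 0) + count (λ x → p (suc x) ∧ not ⌊ x ≟ e ⌋))
  ≡⟨ cong (λ c → suc (_ + c)) (count-cong (λ x → cong (λ b → p (suc x) ∧ not b)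
                                              (sym (⌊⌋-map′ (cong suc) Fin.suc-injective (x ≟ e))))) ⟩
    suc ((if p zero ∧ true then 1 else 0) + count (λ x → p (suc x) ∧ not ⌊ suc x ≟ suc e ⌋)) ∎
  where open ≡-Reasoning

count-all : ∀ m → count {m} (λ _ → true) ≡ m
count-all zero    = refl
count-all (suc m) = cong suc (count-all m)

all-decided : ∀ {m} (d : Fin m → Bool) → count (not ∘ d) ≡ 0 → ∀ x → T (d x)
all-decided d c x with d x in dx
... | true  = tt
... | false = ⊥-elim (count-zero (not ∘ d) c x (subst (T ∘ not) (sym dx) tt))

-- The two ways of growing a partial structure on Fin m one point at a time:
-- declaring a point e decided, and updating a function at e.
opaque
  decide : ∀ {m} → (Fin m → Bool) → Fin m → Fin m → Bool
  decide d e x = d x ∨ ⌊ x ≟ e ⌋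

  update : ∀ {m} {A : Set} → (Fin m → A) → Fin m → A → Fin m → A
  update f e v x = if ⌊ x ≟ e ⌋ then v else f x

module _ {m : ℕ} where
  opaque
    unfolding decide update

    update-here : ∀ {A : Set} (f : Fin m → A) e v → update f e v e ≡ v
    update-here f e v with e ≟ e
    ... | yes _ = refl
    ... | no ne = ⊥-elim (ne refl)

    update-there : ∀ {A : Set} (f : Fin m → A) e v x → ¬ x ≡ e → update f e v x ≡ f x
    update-there f e v x ne with x ≟ e
    ... | yes q = ⊥-elim (ne q)
    ... | no _  = refl

    decided≢ : ∀ {d : Fin m → Bool} {e x} → T (not (d e)) → T (d x) → ¬ x ≡ e
    decided≢ ne dx refl = not-elim ne dx

    update-decided : ∀ {A : Set} {d : Fin m → Bool} {e x} (f : Fin m → A) v →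
      T (not (d e)) → T (d x) → update f e v x ≡ f x
    update-decided f v ne dx = update-there f _ v _ (decided≢ ne dx)

    decide-new : ∀ (d : Fin m → Bool) e → T (decide d e e)
    decide-new d e = ∨-right {d e} (fromWitness refl)

    decide-old : ∀ {d : Fin m → Bool} {e x} → T (d x) → T (decide d e x)
    decide-old = ∨-left

    decide-cases : ∀ (d : Fin m → Bool) e {x} → T (decide d e x) → T (d x) ⊎ x ≡ e
    decide-cases d e {x} t with ∨-cases {d x} t
    ... | inj₁ dx = inj₁ dx
    ... | inj₂ q  = inj₂ (toWitness q)

    count-decide : ∀ (d : Fin m → Bool) e {u} → T (not (d e)) → count (not ∘ d) ≡ suc u → count (not ∘ decide d e) ≡ u
    count-decide d e ne c = ℕ.suc-injective (begin
        suc (count (not ∘ decide d e))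
      ≡⟨ cong suc (count-cong (λ x → not-∨ (d x) ⌊ x ≟ e ⌋)) ⟩
        suc (count (λ x → not (d x) ∧ not ⌊ x ≟ e ⌋))
      ≡⟨ sym (count-remove (not ∘ d) e ne) ⟩
        count (not ∘ d)
      ≡⟨ c ⟩
        suc _ ∎)
      where open ≡-Reasoning

Fin-cong : ∀ {a b} → a ≡ b → Fin a ↔ Fin b
Fin-cong refl = ↔-refl

Σ-count : ∀ {A : Set} {B : A → Set} {a b} → A ↔ Fin a → (∀ x → B x ↔ Fin b) → Σ A B ↔ Fin (a * b)
Σ-count A↔ B↔ = ↔-trans (Σ-↔ A↔ (λ {x} → B↔ x)) (↔-sym *↔×)

module PartialInvolutions {m : ℕ} where

  IsPartialInvolution : (Fin m → Bool) → (Fin m → Fin m) → Set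
  IsPartialInvolution d g = ∀ x → T (d x) → T (d (g x)) × g (g x) ≡ x

  -- The table f agrees with g on the decided points (a Boolean, so that its
  -- proofs are unique); opaque, it is only used through agrees-intro/elim.
  opaque
    agreesᵇ : (Fin m → Bool) → (Fin m → Fin m) → Vec (Fin m) m → Bool
    agreesᵇ d g f = ∀ᵇ (λ x → d x ⇒ᵇ ⌊ lookup f x ≟ g x ⌋)

  Extension : (Fin m → Bool) → (Fin m → Fin m) → Set
  Extension d g = Σ (Involution m) (λ F → T (agreesᵇ d g (proj₁ F)))

  involutive : (F : Involution m) → ∀ i → lookup (proj₁ F) (lookup (proj₁ F) i) ≡ i
  involutive F i = toWitness (∀ᵇ-elim (proj₂ F) i)

  opaque
    unfolding agreesᵇ

    agrees-intro : ∀ {d g f} → (∀ x → T (d x) → lookup f x ≡ g x) → T (agreesᵇ d g f)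
    agrees-intro h = ∀ᵇ-intro (λ x → ⇒ᵇ-intro (λ dx → fromWitness (h x dx)))

    agrees-elim : ∀ {d g f} → T (agreesᵇ d g f) → ∀ x → T (d x) → lookup f x ≡ g x
    agrees-elim c x dx = toWitness (⇒ᵇ-elim (∀ᵇ-elim c x) dx)

  agrees-restrict : ∀ {d g d′ g′ f} → (∀ x → T (d x) → T (d′ x) × g′ x ≡ g x) →
    T (agreesᵇ d′ g′ f) → T (agreesᵇ d g f)
  agrees-restrict r c = agrees-intro (λ x dx → trans (agrees-elim c x (proj₁ (r x dx))) (proj₂ (r x dx)))

  Extension-≡ : ∀ {d g} {E E′ : Extension d g} → proj₁ (proj₁ E) ≡ proj₁ (proj₁ E′) → E ≡ E′
  Extension-≡ eq = Σ-T-≡ (Σ-T-≡ eq)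

  extension-total : ∀ d g → (∀ x → T (d x)) → IsPartialInvolution d g → Extension d g ↔ Fin 1
  extension-total d g total I = mk↔ₛ′ (λ _ → zero) (λ _ → G) (λ { zero → refl }) unique
    where
    lookup-g : ∀ i → lookup (tabulate g) i ≡ g i
    lookup-g = lookup∘tabulate g
    G : Extension d g
    G = (tabulate g , ∀ᵇ-intro (λ i → fromWitness (begin
          lookup (tabulate g) (lookup (tabulate g) i) ≡⟨ cong (lookup (tabulate g)) (lookup-g i) ⟩
          lookup (tabulate g) (g i)                   ≡⟨ lookup-g (g i) ⟩
          g (g i)                                     ≡⟨ proj₂ (I i (total i)) ⟩
          i                                           ∎)))
        , agrees-intro (λ x _ → lookup-g x)
      where open ≡-Reasoning
    unique : ∀ E → G ≡ E
    unique (F , c) = Extension-≡ (Vec-ext _ _ (λ i → trans (lookup-g i) (sym (agrees-elim c i (total i)))))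

  -- The extensions of (d, g) split according to the image of an undecided point e.
  module Step (d : Fin m → Bool) (g : Fin m → Fin m) (e : Fin m)
              (undecided-e : T (not (d e))) (I : IsPartialInvolution d g) where

    -- The states reached by fixing e, and by pairing e with another undecided point y.
    Fixed : Set
    Fixed = Extension (decide d e) (update g e e)

    Undecided : Set
    Undecided = Σ (Fin m) (λ y → T (not (decide d e y)))

    Paired : Undecided → Set
    Paired (y , _) = Extension (decide (decide d e) y) (update (update g e y) y e)

    undecided≢e : ∀ {y} → T (not (decide d e y)) → ¬ y ≡ e
    undecided≢e uy refl = not-elim uy (decide-new d e)

    fix : (F : Involution m) → T (agreesᵇ d g (proj₁ F)) → lookup (proj₁ F) e ≡ e → Fixed
    fix F c fe = F , agrees-intro agree
      where
      agree : ∀ x → T (decide d e x) → lookup (proj₁ F) x ≡ update g e e x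
      agree x dx with decide-cases d e dx
      ... | inj₁ old  = trans (agrees-elim c x old) (sym (update-decided g e undecided-e old))
      ... | inj₂ refl = trans fe (sym (update-here g e e))

    partner-undecided : (F : Involution m) → T (agreesᵇ d g (proj₁ F)) → ¬ lookup (proj₁ F) e ≡ e →
      T (not (decide d e (lookup (proj₁ F) e)))
    partner-undecided F c nfe = not-intro (λ t → case-split (decide-cases d e t))
      where
      y : Fin m
      y = lookup (proj₁ F) e
      case-split : T (d y) ⊎ y ≡ e → ⊥
      case-split (inj₂ ye) = nfe ye
      case-split (inj₁ dy) = not-elim undecided-e
        (subst (T ∘ d) (trans (sym (agrees-elim c y dy)) (involutive F e)) (proj₁ (I y dy)))

    pair : (F : Involution m) → T (agreesᵇ d g (proj₁ F)) → ¬ lookup (proj₁ F) e ≡ e → Σ Undecided Paired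
    pair F c nfe = (y , uy) , (F , agrees-intro agree)
      where
      y : Fin m
      y = lookup (proj₁ F) e
      uy : T (not (decide d e y))
      uy = partner-undecided F c nfe
      agree : ∀ x → T (decide (decide d e) y x) → lookup (proj₁ F) x ≡ update (update g e y) y e x
      agree x dx with decide-cases (decide d e) y dx
      ... | inj₂ refl = trans (involutive F e) (sym (update-here _ y e))
      ... | inj₁ dx′ with decide-cases d e dx′
      ...   | inj₂ refl = sym (trans (update-there _ y e e (λ ey → undecided≢e uy (sym ey))) (update-here g e y))
      ...   | inj₁ old  = trans (agrees-elim c x old)
                            (sym (trans (update-decided _ e uy (decide-old old)) (update-decided g y undecided-e old)))

    to : Extension d g → Fixed ⊎ Σ Undecided (Paired)
    to (F , c) with lookup (proj₁ F) e ≟ e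
    ... | yes fe = inj₁ (fix F c fe)
    ... | no nfe = inj₂ (pair F c nfe)

    from : Fixed ⊎ Σ Undecided (Paired) → Extension d g
    from (inj₁ (F , c)) = F , agrees-restrict (λ x dx → decide-old dx , update-decided g e undecided-e dx) c
    from (inj₂ ((y , uy) , (F , c))) = F , agrees-restrict refines c
      where
      refines : ∀ x → T (d x) → T (decide (decide d e) y x) × update (update g e y) y e x ≡ g x
      refines x dx = decide-old (decide-old dx)
                   , trans (update-decided _ e uy (decide-old dx)) (update-decided g y undecided-e dx)

    from-to : ∀ E → from (to E) ≡ E
    from-to (F , c) with lookup (proj₁ F) e ≟ e
    ... | yes _ = Extension-≡ refl
    ... | no _  = Extension-≡ refl

    paired-image : ∀ y (F : Involution m) → T (agreesᵇ (decide (decide d e) y) (update (update g e y) y e) (proj₁ F)) →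
      ¬ y ≡ e → lookup (proj₁ F) e ≡ y
    paired-image y F c ye = trans (agrees-elim c e (decide-old (decide-new d e)))
                                  (trans (update-there _ y e e (λ ey → ye (sym ey))) (update-here g e y))

    to-from : ∀ t → to (from t) ≡ t
    to-from (inj₁ (F , c)) with lookup (proj₁ F) e ≟ e
    ... | yes _  = cong inj₁ (Extension-≡ refl)
    ... | no nfe = ⊥-elim (nfe (trans (agrees-elim c e (decide-new d e)) (update-here g e e)))
    to-from (inj₂ ((y , uy) , (F , c))) with lookup (proj₁ F) e ≟ e
    ... | yes fe = ⊥-elim (undecided≢e uy (trans (sym (paired-image y F c (undecided≢e uy))) fe))
    ... | no nfe = same-pair (paired-image y F c (undecided≢e uy)) _ uy _ c
      where
      same-pair : ∀ {y y′} (q : y ≡ y′) uy uy′ c c′ →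
        _≡_ {A = Fixed ⊎ Σ Undecided (Paired)} (inj₂ ((y , uy) , (F , c))) (inj₂ ((y′ , uy′) , (F , c′)))
      same-pair refl uy uy′ c c′ with T-irrelevant uy uy′ | T-irrelevant c c′
      ... | refl | refl = refl

    extension-step : Extension d g ↔ (Fixed ⊎ Σ Undecided (Paired))
    extension-step = mk↔ₛ′ to from to-from from-to

  fixed-invariant : ∀ d g e → T (not (d e)) → IsPartialInvolution d g →
    IsPartialInvolution (decide d e) (update g e e)
  fixed-invariant d g e ne I x dx with decide-cases d e dx
  ... | inj₂ refl = subst (T ∘ decide d e) (sym (update-here g e e)) (decide-new d e)
                  , trans (cong (update g e e) (update-here g e e)) (update-here g e e)
  ... | inj₁ old  = let (dgx , ggx) = I x old ; gx≡ = update-decided g e ne old in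
      subst (T ∘ decide d e) (sym gx≡) (decide-old dgx)
    , trans (cong (update g e e) gx≡) (trans (update-decided g e ne dgx) ggx)

  paired-invariant : ∀ d g e y → T (not (d e)) → T (not (decide d e y)) → IsPartialInvolution d g →
    IsPartialInvolution (decide (decide d e) y) (update (update g e y) y e)
  paired-invariant d g e y ne uy I x dx = by-cases (decide-cases (decide d e) y dx)
    where
    d′ : Fin m → Bool
    d′ = decide (decide d e) y
    g′ : Fin m → Fin m
    g′ = update (update g e y) y e
    y≢e : ¬ y ≡ e
    y≢e ye = not-elim uy (subst (T ∘ decide d e) (sym ye) (decide-new d e))
    g′y : g′ y ≡ e
    g′y = update-here _ y e
    g′e : g′ e ≡ y
    g′e = trans (update-there _ y e e (λ ey → y≢e (sym ey))) (update-here g e y)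
    g′-old : ∀ {z} → T (d z) → g′ z ≡ g z
    g′-old dz = trans (update-decided _ e uy (decide-old dz)) (update-decided g y ne dz)
    by-cases : (T (decide d e x) ⊎ x ≡ y) → T (d′ (g′ x)) × g′ (g′ x) ≡ x
    by-cases (inj₂ refl) = subst (T ∘ d′) (sym g′y) (decide-old (decide-new d e)) , trans (cong g′ g′y) g′e
    by-cases (inj₁ dx′) with decide-cases d e dx′
    ... | inj₂ refl = subst (T ∘ d′) (sym g′e) (decide-new (decide d e) y) , trans (cong g′ g′e) g′y
    ... | inj₁ old  = let (dgx , ggx) = I x old in
        subst (T ∘ d′) (sym (g′-old old)) (decide-old (decide-old dgx))
      , trans (cong g′ (g′-old old)) (trans (g′-old dgx) ggx)

  count-extensions : ∀ u d g → count (not ∘ d) ≡ u → IsPartialInvolution d g → Extension d g ↔ Fin (involutions u)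
  count-extensions zero d g c I = extension-total d g (all-decided d c) I
  count-extensions (suc u) d g c I = begin
      Extension d g
    ↔⟨ extension-step ⟩
      (Fixed ⊎ Σ Undecided Paired)
    ↔⟨ count-extensions u (decide d e) (update g e e) c′ (fixed-invariant d g e ne I)
       ⊎-↔ Σ-count (↔-trans (count↔ _) (Fin-cong c′)) (count-paired c′) ⟩
      (Fin (involutions u) ⊎ Fin (u * involutions (pred u)))
    ↔⟨ ↔-sym +↔⊎ ⟩
      Fin (involutions u + u * involutions (pred u))
    ≡⟨ cong Fin (recurrence u) ⟩
      Fin (involutions (suc u)) ∎
    where
    open Related.EquationalReasoning
    e : Fin m
    e = proj₁ (count-suc (not ∘ d) c)
    ne : T (not (d e))
    ne = proj₂ (count-suc (not ∘ d) c)
    open Step d g e ne I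
    c′ : count (not ∘ decide d e) ≡ u
    c′ = count-decide d e ne c
    recurrence : ∀ u → involutions u + u * involutions (pred u) ≡ involutions (suc u)
    recurrence zero    = refl
    recurrence (suc u) = refl
    -- e is paired with one of the u points still undecided, after which u - 1 remain.
    count-paired : ∀ {u} → count (not ∘ decide d e) ≡ u → (y : Undecided) → Paired y ↔ Fin (involutions (pred u))
    count-paired {zero}   c₀ (y , uy) = ⊥-elim (count-zero _ c₀ y uy)
    count-paired {suc u′} c₀ (y , uy) =
      count-extensions u′ _ _ (count-decide (decide d e) y uy c₀) (paired-invariant d g e y ne uy I)

-- t(m) = #Involution m: an involution is an extension of the empty partial involution.
involutions↔ : ∀ m → Involution m ↔ Fin (involutions m)
involutions↔ m = ↔-trans as-extension (count-extensions m (λ _ → false) id (count-all m) (λ _ ()))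
  where
  open PartialInvolutions {m}
  as-extension : Involution m ↔ Extension (λ _ → false) id
  as-extension = mk↔ₛ′ (λ F → F , agrees-intro (λ _ ())) proj₁ (λ _ → Extension-≡ refl) (λ _ → refl)

counts-involutions : (t : ℕ → ℕ) → ((m : ℕ) → Fin (t m) ↔ Involution m) → ∀ m → t m ≡ involutions m
counts-involutions t H m = ↔⇒≡ (↔-trans (H m) (involutions↔ m))

private
  variable
    j k : ℕ

-- Where a point of a type-B partition with j pairs ±B₀, …, ±B_{j-1} of
-- non-zero blocks may lie: in the zero block, or in B_t (block true t) or in -B_t (block false t).
data Place (j : ℕ) : Set where
  zeroBlock : Place j
  block     : Bool → Fin j → Place j

-- The place of -x when x is placed at a.
flip : Place j → Place j
flip zeroBlock   = zeroBlock
flip (block s t) = block (not s) t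

flip-flip : ∀ (a : Place j) → flip (flip a) ≡ a
flip-flip zeroBlock       = refl
flip-flip (block true t)  = refl
flip-flip (block false t) = refl

-- Opening a new pair of blocks B₀: the old blocks are renumbered.
lift : Place j → Place (suc j)
lift zeroBlock   = zeroBlock
lift (block s t) = block s (suc t)

lift-flip : ∀ (a : Place j) → flip (lift a) ≡ lift (flip a)
lift-flip zeroBlock   = refl
lift-flip (block s t) = refl

lift-injective : ∀ {a b : Place j} → lift a ≡ lift b → a ≡ b
lift-injective {a = zeroBlock}  {zeroBlock}   _    = refl
lift-injective {a = block s t}  {block .s .t} refl = refl

_≟ₚ_ : DecidableEquality (Place j)
zeroBlock ≟ₚ zeroBlock     = yes refl
zeroBlock ≟ₚ block _ _     = no λ ()
block _ _ ≟ₚ zeroBlock     = no λ ()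
block s t ≟ₚ block s′ t′   =
  map′ (λ (p , q) → cong₂ block p q) (λ { refl → refl , refl }) ((s Bool.≟ s′) ×-dec (t ≟ t′))

same : Place j → Place j → Bool
same a b = ⌊ a ≟ₚ b ⌋


same-refl : ∀ (a : Place j) → same a a ≡ true
same-refl a = T-true (fromWitness refl)

same-≡ : ∀ {a b : Place j} → T (same a b) → a ≡ b
same-≡ = toWitness

same-≢ : ∀ (a b : Place j) → ¬ a ≡ b → same a b ≡ false
same-≢ a b ne = T-ext (λ t → ⊥-elim (ne (toWitness t))) (λ ())

same-sym : ∀ (a b : Place j) → same a b ≡ same b a
same-sym a b = T-ext (λ t → fromWitness (sym (toWitness t))) (λ t → fromWitness (sym (toWitness t)))

same-injective : (φ : Place j → Place k) → (∀ {a b} → φ a ≡ φ b → a ≡ b) →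
  ∀ a b → same (φ a) (φ b) ≡ same a b
same-injective φ inj a b = T-ext (λ t → fromWitness (inj (toWitness t))) (λ t → fromWitness (cong φ (toWitness t)))

same-flip : ∀ (a b : Place j) → same (flip a) (flip b) ≡ same a b
same-flip = same-injective flip (λ {a} {b} q → trans (sym (flip-flip a)) (trans (cong flip q) (flip-flip b)))

same-flipʳ : ∀ (a b : Place j) → same a (flip b) ≡ same (flip a) b
same-flipʳ a b = trans (sym (same-flip a (flip b))) (cong (same (flip a)) (flip-flip b))

same-self-flip : ∀ (a : Place j) → same a (flip a) ≡ same zeroBlock a
same-self-flip zeroBlock       = refl
same-self-flip (block true t)  = same-≢ (block true t) (block false t) λ ()
same-self-flip (block false t) = same-≢ (block false t) (block true t) λ ()

new-block-fresh : ∀ (a : Place j) → same (block true zero) (lift a) ≡ false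
new-block-fresh zeroBlock   = refl
new-block-fresh (block s t) = same-≢ (block true zero) (block s (suc t)) λ ()

places↔ : Place j ↔ Fin (suc (j + j))
places↔ = ↔-trans as-sum (↔-trans (↔-sym 1↔⊤ ⊎-↔ ↔-sym +↔⊎) (↔-sym +↔⊎))
  where
  as-sum : Place j ↔ (⊤ ⊎ (Fin j ⊎ Fin j))
  as-sum = mk↔ₛ′ (λ { zeroBlock → inj₁ tt ; (block true t) → inj₂ (inj₁ t) ; (block false t) → inj₂ (inj₂ t) })
                 (λ { (inj₁ _) → zeroBlock ; (inj₂ (inj₁ t)) → block true t ; (inj₂ (inj₂ t)) → block false t })
                 (λ { (inj₁ _) → refl ; (inj₂ (inj₁ t)) → refl ; (inj₂ (inj₂ t)) → refl })
                 (λ { zeroBlock → refl ; (block true t) → refl ; (block false t) → refl })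

module TypeB (n : ℕ) where

  -- [±n] as two copies of Fin n: inj₁ i is i+1, inj₂ i is -(i+1), and swap is x ↦ -x.
  Signed : Set
  Signed = Fin n ⊎ Fin n

  ∣_∣ : Signed → Fin n
  ∣ inj₁ i ∣ = i
  ∣ inj₂ i ∣ = i

  ∣swap∣ : ∀ u → ∣ swap u ∣ ≡ ∣ u ∣
  ∣swap∣ (inj₁ _) = refl
  ∣swap∣ (inj₂ _) = refl

  point : Signed → PM n
  point = join n n

  neg-point : ∀ u → neg {n} (point u) ≡ point (swap u)
  neg-point u = cong (join n n ∘ swap) (splitAt-join n n u)

  _~[_]_ : Signed → Rel (n + n) → Signed → Bool
  u ~[ R ] v = point u ∼[ R ] point v

  record IsTypeB (r : Signed → Signed → Bool) : Set where
    field
      reflexive  : ∀ u → T (r u u)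
      symmetric  : ∀ u v → T (r u v) → T (r v u)
      transitive : ∀ u v w → T (r u v) → T (r v w) → T (r u w)
      negation   : ∀ u v → T (r u v) → T (r (swap u) (swap v))
      zero-block : ∀ u v → T (r u (swap u)) → T (r v (swap v)) → T (r u v)

  module Laws (r : Signed → Signed → Bool) (ax : IsTypeB r) where
    open IsTypeB ax public

    r-sym : ∀ u v → r u v ≡ r v u
    r-sym u v = T-ext (symmetric u v) (symmetric v u)

    r-swap : ∀ u v → r (swap u) (swap v) ≡ r u v
    r-swap u v = T-ext (λ p → subst₂ (λ a b → T (r a b)) (swap-involutive u) (swap-involutive v) (negation _ _ p))
                       (negation u v)

    r-subst : ∀ u w y → T (r u w) → r u y ≡ r w y
    r-subst u w y p = T-ext (transitive w u y (symmetric u w p)) (transitive u w y p)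

  module Conjuncts (R : Rel (n + n)) where
    Refl Sym Trans Neg Zero : Bool
    Refl  = ∀ᵇ (λ x → x ∼[ R ] x)
    Sym   = ∀ᵇ (λ x → ∀ᵇ (λ y → (x ∼[ R ] y) ⇒ᵇ (y ∼[ R ] x)))
    Trans = ∀ᵇ (λ x → ∀ᵇ (λ y → ∀ᵇ (λ z → ((x ∼[ R ] y) ∧ (y ∼[ R ] z)) ⇒ᵇ (x ∼[ R ] z))))
    Neg   = ∀ᵇ (λ x → ∀ᵇ (λ y → (x ∼[ R ] y) ⇒ᵇ (neg {n} x ∼[ R ] neg {n} y)))
    Zero  = ∀ᵇ (λ x → ∀ᵇ (λ y → ((x ∼[ R ] neg {n} x) ∧ (y ∼[ R ] neg {n} y)) ⇒ᵇ (x ∼[ R ] y)))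

  typeB-elim : ∀ R → T (isTypeBᵇ {n} R) → IsTypeB (λ u v → u ~[ R ] v)
  typeB-elim R t = record
    { reflexive  = λ u → ∀ᵇ-elim refl-ax (point u)
    ; symmetric  = λ u v → ⇒ᵇ-elim (∀ᵇ-elim (∀ᵇ-elim sym-ax (point u)) (point v))
    ; transitive = λ u v w p q →
        ⇒ᵇ-elim (∀ᵇ-elim (∀ᵇ-elim (∀ᵇ-elim trans-ax (point u)) (point v)) (point w)) (∧-intro p q)
    ; negation   = λ u v p → subst₂ (λ a b → T (a ∼[ R ] b)) (neg-point u) (neg-point v)
        (⇒ᵇ-elim (∀ᵇ-elim (∀ᵇ-elim neg-ax (point u)) (point v)) p)
    ; zero-block = λ u v p q → ⇒ᵇ-elim (∀ᵇ-elim (∀ᵇ-elim zero-ax (point u)) (point v))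
        (∧-intro (subst (λ a → T (point u ∼[ R ] a)) (sym (neg-point u)) p)
                 (subst (λ a → T (point v ∼[ R ] a)) (sym (neg-point v)) q))
    }
    where
    open Conjuncts R
    refl-ax : T Refl
    refl-ax = ∧-left {Refl} (∧-left {isEquivᵇ R} t)
    sym-ax : T Sym
    sym-ax = ∧-left {Sym} (∧-right {Refl} (∧-left {isEquivᵇ R} t))
    trans-ax : T Trans
    trans-ax = ∧-right {Sym} (∧-right {Refl} (∧-left {isEquivᵇ R} t))
    neg-ax : T Neg
    neg-ax = ∧-left {Neg} (∧-right {isEquivᵇ R} t)
    zero-ax : T Zero
    zero-ax = ∧-right {Neg} (∧-right {isEquivᵇ R} t)

  typeB-intro : ∀ R (r : Signed → Signed → Bool) → (∀ x y → (x ∼[ R ] y) ≡ r (splitAt n x) (splitAt n y)) →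
    IsTypeB r → T (isTypeBᵇ {n} R)
  typeB-intro R r R≡r ax =
    ∧-intro {isEquivᵇ R} (∧-intro {Refl} refl-ok (∧-intro {Sym} sym-ok trans-ok)) (∧-intro {Neg} neg-ok zero-ok)
    where
    open Conjuncts R
    open IsTypeB ax
    to : ∀ x y → T (x ∼[ R ] y) → T (r (splitAt n x) (splitAt n y))
    to x y = subst T (R≡r x y)
    from : ∀ x y → T (r (splitAt n x) (splitAt n y)) → T (x ∼[ R ] y)
    from x y = subst T (sym (R≡r x y))
    splitAt-neg : ∀ x → splitAt n (neg {n} x) ≡ swap (splitAt n x)
    splitAt-neg x = splitAt-join n n (swap (splitAt n x))
    to-neg : ∀ x → T (x ∼[ R ] neg {n} x) → T (r (splitAt n x) (swap (splitAt n x)))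
    to-neg x p = subst (λ w → T (r (splitAt n x) w)) (splitAt-neg x) (to x (neg {n} x) p)
    from-neg : ∀ x y → T (r (swap (splitAt n x)) (swap (splitAt n y))) → T (neg {n} x ∼[ R ] neg {n} y)
    from-neg x y p = from (neg {n} x) (neg {n} y) (subst₂ (λ a b → T (r a b)) (sym (splitAt-neg x)) (sym (splitAt-neg y)) p)
    refl-ok : T Refl
    refl-ok = ∀ᵇ-intro λ x → from x x (reflexive _)
    sym-ok : T Sym
    sym-ok = ∀ᵇ-intro λ x → ∀ᵇ-intro λ y → ⇒ᵇ-intro λ p → from y x (symmetric _ _ (to x y p))
    trans-ok : T Trans
    trans-ok = ∀ᵇ-intro λ x → ∀ᵇ-intro λ y → ∀ᵇ-intro λ z → ⇒ᵇ-intro λ p →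
      from x z (transitive _ _ _ (to x y (∧-left p)) (to y z (∧-right p)))
    neg-ok : T Neg
    neg-ok = ∀ᵇ-intro λ x → ∀ᵇ-intro λ y → ⇒ᵇ-intro λ p → from-neg x y (negation _ _ (to x y p))
    zero-ok : T Zero
    zero-ok = ∀ᵇ-intro λ x → ∀ᵇ-intro λ y → ⇒ᵇ-intro λ p →
      from x y (zero-block _ _ (to-neg x (∧-left p)) (to-neg y (∧-right p)))

  signed : (Fin n → Place j) → Signed → Place j
  signed lab (inj₁ i) = lab i
  signed lab (inj₂ i) = flip (lab i)

  signed-swap : ∀ (lab : Fin n → Place j) u → signed lab (swap u) ≡ flip (signed lab u)
  signed-swap lab (inj₁ i) = refl
  signed-swap lab (inj₂ i) = sym (flip-flip (lab i))

  same-label-typeB : ∀ (lab : Fin n → Place j) → IsTypeB (λ u v → same (signed lab u) (signed lab v))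
  same-label-typeB lab = record
    { reflexive  = λ u → fromWitness refl
    ; symmetric  = λ u v p → fromWitness (sym (same-≡ p))
    ; transitive = λ u v w p q → fromWitness (trans (same-≡ p) (same-≡ q))
    ; negation   = λ u v p → fromWitness (trans (signed-swap lab u) (trans (cong flip (same-≡ p)) (sym (signed-swap lab v))))
    ; zero-block = λ u v p q → fromWitness (trans (is-zero u p) (sym (is-zero v q)))
    }
    where
    is-zero : ∀ u → T (same (signed lab u) (signed lab (swap u))) → signed lab u ≡ zeroBlock
    is-zero u p = sym (same-≡ (subst T (trans (cong (same _) (signed-swap lab u)) (same-self-flip _)) p))

  Consistent : (Fin n → Bool) → (Fin n → Place j) → Rel (n + n) → Set
  Consistent d lab R = ∀ u v → T (d ∣ u ∣) → T (d ∣ v ∣) → u ~[ R ] v ≡ same (signed lab u) (signed lab v)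

  -- The same condition as a Boolean (so that its proofs are unique).
  opaque
    consistentᵇ : (Fin n → Bool) → (Fin n → Place j) → Rel (n + n) → Bool
    consistentᵇ d lab R = ∀ᵇ λ x → ∀ᵇ λ y → (d ∣ splitAt n x ∣ ∧ d ∣ splitAt n y ∣) ⇒ᵇ
      ⌊ (x ∼[ R ] y) Bool.≟ same (signed lab (splitAt n x)) (signed lab (splitAt n y)) ⌋

    consistent-intro : ∀ {d} {lab : Fin n → Place j} {R} → Consistent d lab R → T (consistentᵇ d lab R)
    consistent-intro {R = R} k = ∀ᵇ-intro λ x → ∀ᵇ-intro λ y → ⇒ᵇ-intro λ dxy → fromWitness
      (trans (cong₂ (λ a b → a ∼[ R ] b) (sym (join-splitAt n n x)) (sym (join-splitAt n n y)))
             (k (splitAt n x) (splitAt n y) (∧-left dxy) (∧-right dxy)))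

    consistent-elim : ∀ {d} {lab : Fin n → Place j} {R} → T (consistentᵇ d lab R) → Consistent d lab R
    consistent-elim {d = d} {lab = lab} {R = R} k u v du dv = subst₂ (λ a b → u ~[ R ] v ≡ same (signed lab a) (signed lab b))
      (splitAt-join n n u) (splitAt-join n n v)
      (toWitness (⇒ᵇ-elim (∀ᵇ-elim (∀ᵇ-elim k (point u)) (point v))
                          (∧-intro (subst (T ∘ d ∘ ∣_∣) (sym (splitAt-join n n u)) du)
                                   (subst (T ∘ d ∘ ∣_∣) (sym (splitAt-join n n v)) dv))))

  Completion : ∀ j → (Fin n → Bool) → (Fin n → Place j) → Set
  Completion j d lab = Σ (PiB n) (λ P → T (consistentᵇ d lab (proj₁ P)))

  Completion-≡ : ∀ {d} {lab : Fin n → Place j} {C C′ : Completion j d lab} → proj₁ (proj₁ C) ≡ proj₁ (proj₁ C′) → C ≡ C′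
  Completion-≡ eq = Σ-T-≡ (Σ-T-≡ eq)

  completion-total : ∀ d (lab : Fin n → Place j) → (∀ x → T (d x)) → Completion j d lab ↔ Fin 1
  completion-total {j = j} d lab total = mk↔ₛ′ (λ _ → zero) (λ _ → C₀) (λ { zero → refl }) unique
    where
    L : PM n → Place j
    L x = signed lab (splitAt n x)
    R₀ : Rel (n + n)
    R₀ = tabulate λ x → tabulate λ y → same (L x) (L y)
    R₀-entry : ∀ x y → (x ∼[ R₀ ] y) ≡ same (L x) (L y)
    R₀-entry x y = trans (cong (λ row → lookup row y) (lookup∘tabulate _ x)) (lookup∘tabulate _ y)
    C₀ : Completion j d lab
    C₀ = (R₀ , typeB-intro R₀ _ R₀-entry (same-label-typeB lab))
       , consistent-intro (λ u v _ _ → trans (R₀-entry (point u) (point v))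
                                             (cong₂ (λ a b → same (signed lab a) (signed lab b)) (splitAt-join n n u) (splitAt-join n n v)))
    unique : ∀ C → C₀ ≡ C
    unique ((R , _) , k) = Completion-≡ (Vec-ext _ _ λ x → Vec-ext _ _ λ y → begin
        x ∼[ R₀ ] y
      ≡⟨ R₀-entry x y ⟩
        same (L x) (L y)
      ≡⟨ sym (consistent-elim k (splitAt n x) (splitAt n y) (total _) (total _)) ⟩
        point (splitAt n x) ∼[ R ] point (splitAt n y)
      ≡⟨ cong₂ (λ a b → a ∼[ R ] b) (join-splitAt n n x) (join-splitAt n n y) ⟩
        x ∼[ R ] y ∎)
      where open ≡-Reasoning

  Represents : ∀ j → (Fin n → Bool) → (Fin n → Place j) → (Fin j → Fin n) → Set
  Represents j d lab rep = ∀ t → T (d (rep t)) × lab (rep t) ≡ block true t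

  -- Deciding the undecided point e: +e goes to the zero block, to an open block ±B_t, or to a new one.
  module Step {j} (d : Fin n → Bool) (lab : Fin n → Place j) (rep : Fin j → Fin n)
              (e : Fin n) (undecided-e : T (not (d e))) (reps : Represents j d lab rep) where

    P N : Signed
    P = inj₁ e
    N = inj₂ e

    repPoint : Bool → Fin j → Signed
    repPoint true  t = inj₁ (rep t)
    repPoint false t = inj₂ (rep t)

    repPoint-decided : ∀ s t → T (d ∣ repPoint s t ∣)
    repPoint-decided true  t = proj₁ (reps t)
    repPoint-decided false t = proj₁ (reps t)

    repPoint-label : ∀ s t → signed lab (repPoint s t) ≡ block s t
    repPoint-label true  t = proj₂ (reps t)
    repPoint-label false t = cong flip (proj₂ (reps t))

    classify : ∀ y → T (decide d e ∣ y ∣) → T (d ∣ y ∣) ⊎ (y ≡ P ⊎ y ≡ N)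
    classify (inj₁ i) t with decide-cases d e t
    ... | inj₁ di   = inj₁ di
    ... | inj₂ refl = inj₂ (inj₁ refl)
    classify (inj₂ i) t with decide-cases d e t
    ... | inj₁ di   = inj₁ di
    ... | inj₂ refl = inj₂ (inj₂ refl)

    module Extend {k} (φ : Place j → Place k) (φ-injective : ∀ {a b} → φ a ≡ φ b → a ≡ b)
                  (φ-flip : ∀ a → flip (φ a) ≡ φ (flip a)) (c : Place k) where

      lab′ : Fin n → Place k
      lab′ = update (φ ∘ lab) e c

      L′ : Signed → Place k
      L′ = signed lab′

      L′-P : L′ P ≡ c
      L′-P = update-here (φ ∘ lab) e c

      L′-N : L′ N ≡ flip c
      L′-N = cong flip L′-P

      L′-old : ∀ y → T (d ∣ y ∣) → L′ y ≡ φ (signed lab y)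
      L′-old (inj₁ i) di = update-decided (φ ∘ lab) c undecided-e di
      L′-old (inj₂ i) di = trans (cong flip (update-decided (φ ∘ lab) c undecided-e di)) (φ-flip (lab i))

      restrict : ∀ R → Consistent (decide d e) lab′ R → Consistent d lab R
      restrict R k u v du dv = trans (k u v (decide-old du) (decide-old dv))
        (trans (cong₂ same (L′-old u du) (L′-old v dv)) (same-injective φ φ-injective _ _))

      P-vs-N : ∀ R → Consistent (decide d e) lab′ R → P ~[ R ] N ≡ same c (flip c)
      P-vs-N R k = trans (k P N (decide-new d e) (decide-new d e)) (cong₂ same L′-P L′-N)

      P-vs-old : ∀ R → Consistent (decide d e) lab′ R → ∀ y → T (d ∣ y ∣) → P ~[ R ] y ≡ same c (φ (signed lab y))
      P-vs-old R k y dy = trans (k P y (decide-new d e) (decide-old dy)) (cong₂ same L′-P (L′-old y dy))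

      extend : ∀ R → IsTypeB (λ u v → u ~[ R ] v) → Consistent d lab R →
        P ~[ R ] N ≡ same c (flip c) → (∀ y → T (d ∣ y ∣) → P ~[ R ] y ≡ same c (φ (signed lab y))) →
        Consistent (decide d e) lab′ R
      extend R ax k rel-N rel-old = consistent
        where
        open Laws (λ u v → u ~[ R ] v) ax
        from-P : ∀ y → T (decide d e ∣ y ∣) → P ~[ R ] y ≡ same (L′ P) (L′ y)
        from-P y dy with classify y dy
        ... | inj₁ old        = trans (rel-old y old) (cong₂ same (sym L′-P) (sym (L′-old y old)))
        ... | inj₂ (inj₁ refl) = trans (T-true (reflexive P)) (sym (same-refl (L′ P)))
        ... | inj₂ (inj₂ refl) = trans rel-N (cong₂ same (sym L′-P) (sym L′-N))
        from-N : ∀ y → T (decide d e ∣ y ∣) → N ~[ R ] y ≡ same (L′ N) (L′ y)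
        from-N y dy = begin
            N ~[ R ] y
          ≡⟨ cong (N ~[ R ]_) (sym (swap-involutive y)) ⟩
            swap P ~[ R ] swap (swap y)
          ≡⟨ r-swap P (swap y) ⟩
            P ~[ R ] swap y
          ≡⟨ from-P (swap y) (subst (T ∘ decide d e) (sym (∣swap∣ y)) dy) ⟩
            same (L′ P) (L′ (swap y))
          ≡⟨ cong (same (L′ P)) (signed-swap lab′ y) ⟩
            same (L′ P) (flip (L′ y))
          ≡⟨ same-flipʳ (L′ P) (L′ y) ⟩
            same (flip (L′ P)) (L′ y) ∎
          where open ≡-Reasoning
        consistent : Consistent (decide d e) lab′ R
        consistent u v du dv with classify u du | classify v dv
        ... | inj₂ (inj₁ refl) | _ = from-P v dv
        ... | inj₂ (inj₂ refl) | _ = from-N v dv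
        ... | inj₁ _ | inj₂ (inj₁ refl) = trans (r-sym u P) (trans (from-P u du) (same-sym _ _))
        ... | inj₁ _ | inj₂ (inj₂ refl) = trans (r-sym u N) (trans (from-N u du) (same-sym _ _))
        ... | inj₁ old-u | inj₁ old-v = trans (k u v old-u old-v)
          (trans (sym (same-injective φ φ-injective _ _)) (cong₂ same (sym (L′-old u old-u)) (sym (L′-old v old-v))))

    joins : Rel (n + n) → Fin j → Bool
    joins R t = (P ~[ R ] repPoint true t) ∨ (P ~[ R ] repPoint false t)

    joins-intro : ∀ R s t → T (P ~[ R ] repPoint s t) → T (joins R t)
    joins-intro R true  t p = ∨-left p
    joins-intro R false t p = ∨-right {P ~[ R ] repPoint true t} p

    joined-point : ∀ R t → T (joins R t) → T (P ~[ R ] repPoint (P ~[ R ] repPoint true t) t)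
    joined-point R t jt with P ~[ R ] repPoint true t in eq
    ... | true  = T-from-≡ eq
    ... | false = jt

    place : ∀ R → Bool → Dec (Σ (Fin j) (λ t → T (joins R t))) → Maybe (Place j)
    place R true  _             = just zeroBlock
    place R false (yes (t , _)) = just (block (P ~[ R ] repPoint true t) t)
    place R false (no _)        = nothing

    -- The place of +e in R: the zero block, a block ±B_t, or (nothing) a new block.
    opaque
      placement : Rel (n + n) → Maybe (Place j)
      placement R = place R (P ~[ R ] N) (any? (λ t → T? (joins R t)))

    module Placement (R : Rel (n + n)) (ax : IsTypeB (λ u v → u ~[ R ] v)) (k : Consistent d lab R) where
      open Laws (λ u v → u ~[ R ] v) ax

      attached : ∀ w → T (P ~[ R ] w) → P ~[ R ] N ≡ w ~[ R ] swap w
      attached w pw = T-ext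
        (λ q → transitive w P (swap w) (symmetric P w pw) (transitive P N (swap w) q (negation P w pw)))
        (λ q → transitive P w N pw (transitive w (swap w) N q (symmetric N (swap w) (negation P w pw))))

      in-zero-block : T (P ~[ R ] N) → ∀ y → P ~[ R ] y ≡ y ~[ R ] swap y
      in-zero-block pn y = T-ext
        (λ q → transitive y P (swap y) (symmetric P y q) (transitive P N (swap y) pn (negation P y q)))
        (zero-block P y pn)

      self-neg : ∀ y → T (d ∣ y ∣) → y ~[ R ] swap y ≡ same zeroBlock (signed lab y)
      self-neg y dy = trans (k y (swap y) dy (subst (T ∘ d) (sym (∣swap∣ y)) dy))
                            (trans (cong (same _) (signed-swap lab y)) (same-self-flip _))

      via : ∀ w → T (d ∣ w ∣) → T (P ~[ R ] w) →
        P ~[ R ] N ≡ same (signed lab w) (flip (signed lab w)) × (∀ y → T (d ∣ y ∣) → P ~[ R ] y ≡ same (signed lab w) (signed lab y))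
      via w dw pw = trans (attached w pw) (trans (k w (swap w) dw (subst (T ∘ d) (sym (∣swap∣ w)) dw))
                                                 (cong (same _) (signed-swap lab w)))
                  , λ y dy → trans (r-subst P w y pw) (k w y dw dy)

      opaque
        unfolding placement

        placed : ∀ c → placement R ≡ just c →
          P ~[ R ] N ≡ same c (flip c) × (∀ y → T (d ∣ y ∣) → P ~[ R ] y ≡ same c (signed lab y))
        placed c eq with P ~[ R ] N in pn | any? (λ t → T? (joins R t))
        placed c refl | true  | _ = refl , λ y dy → trans (in-zero-block (T-from-≡ pn) y) (self-neg y dy)
        placed c refl | false | yes (t , jt) =
            trans (sym pn) (subst (λ a → P ~[ R ] N ≡ same a (flip a)) (repPoint-label b t) (proj₁ related))
          , λ y dy → subst (λ a → P ~[ R ] y ≡ same a (signed lab y)) (repPoint-label b t) (proj₂ related y dy)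
          where
          b : Bool
          b = P ~[ R ] repPoint true t
          related : P ~[ R ] N ≡ same (signed lab (repPoint b t)) (flip (signed lab (repPoint b t)))
                  × (∀ y → T (d ∣ y ∣) → P ~[ R ] y ≡ same (signed lab (repPoint b t)) (signed lab y))
          related = via (repPoint b t) (repPoint-decided b t) (joined-point R t jt)

        unplaced : placement R ≡ nothing → P ~[ R ] N ≡ false × (∀ y → T (d ∣ y ∣) → P ~[ R ] y ≡ false)
        unplaced eq with P ~[ R ] N in pn | any? (λ t → T? (joins R t))
        unplaced refl | false | no none = refl , λ y dy → ¬T-false (unrelated y dy)
          where
          unrelated : ∀ y → T (d ∣ y ∣) → T (P ~[ R ] y) → ⊥
          unrelated y dy py with signed lab y in ly
          ... | zeroBlock = T-false (subst T (sym (trans (attached y py) (trans (self-neg y dy) (cong (same zeroBlock) ly)))) tt) pn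
          ... | block s t = none (t , joins-intro R s t (subst T (sym (r-subst P y (repPoint s t) py)) same-block))
            where
            same-block : T (y ~[ R ] repPoint s t)
            same-block = subst T (sym (trans (k y (repPoint s t) dy (repPoint-decided s t))
                                              (cong₂ same ly (repPoint-label s t)))) (fromWitness refl)

    module New    = Extend lift lift-injective lift-flip (block true zero)
    module Old c  = Extend id id (λ _ → refl) c

    P-vs-rep : ∀ R c → Consistent (decide d e) (update lab e c) R → ∀ b t → P ~[ R ] repPoint b t ≡ same c (block b t)
    P-vs-rep R c k′ b t = trans (Old.P-vs-old c R k′ (repPoint b t) (repPoint-decided b t)) (cong (same c) (repPoint-label b t))

    some-join : ∀ R c → Consistent (decide d e) (update lab e c) R → P ~[ R ] N ≡ false → Σ (Fin j) (λ t → T (joins R t))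
    some-join R zeroBlock   k′ pn = ⊥-elim (T-false (subst T (sym (Old.P-vs-N zeroBlock R k′)) tt) pn)
    some-join R (block s t) k′ pn = t , joins-intro R s t (subst T (sym (P-vs-rep R (block s t) k′ s t)) (fromWitness refl))

    opaque
      unfolding placement

      placement-old : ∀ R c → Consistent (decide d e) (update lab e c) R → placement R ≡ just c
      placement-old R c k′ with P ~[ R ] N in pn | any? (λ t → T? (joins R t))
      ... | true  | _ = cong just (same-≡ (subst T (trans (sym pn) (trans (Old.P-vs-N c R k′) (same-self-flip c))) tt))
      ... | false | yes (t , jt) =
        cong just (sym (same-≡ (subst T (P-vs-rep R c k′ (P ~[ R ] repPoint true t) t) (joined-point R t jt))))
      ... | false | no none = ⊥-elim (none (some-join R c k′ pn))

      placement-new : ∀ R → Consistent (decide d e) New.lab′ R → placement R ≡ nothing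
      placement-new R k′ with P ~[ R ] N in pn | any? (λ t → T? (joins R t))
      ... | true  | _ = ⊥-elim (T-false (T-from-≡ pn) (New.P-vs-N R k′))
      ... | false | yes (t , jt) = ⊥-elim (T-false (joined-point R t jt) (trans (New.P-vs-old R k′ (repPoint b t) (repPoint-decided b t))
                                                     (trans (cong (same _ ∘ lift) (repPoint-label b t)) (new-block-fresh (block b t)))))
        where
        b : Bool
        b = P ~[ R ] repPoint true t
      ... | false | no _ = refl

    nothing≢just : ∀ {A : Set} {a : A} {B : Set} → nothing ≡ just a → B
    nothing≢just ()

    Target : Set
    Target = Completion (suc j) (decide d e) New.lab′ ⊎ Σ (Place j) (λ c → Completion j (decide d e) (update lab e c))

    label-new : (C : Completion j d lab) → placement (proj₁ (proj₁ C)) ≡ nothing →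
      Completion (suc j) (decide d e) New.lab′
    label-new ((R , isB) , k) eq = (R , isB) , consistent-intro
      (New.extend R ax k′ (proj₁ rel) (λ y dy → trans (proj₂ rel y dy) (sym (new-block-fresh (signed lab y)))))
      where
      ax : IsTypeB (λ u v → u ~[ R ] v)
      ax = typeB-elim R isB
      k′ : Consistent d lab R
      k′ = consistent-elim k
      rel : P ~[ R ] N ≡ false × (∀ y → T (d ∣ y ∣) → P ~[ R ] y ≡ false)
      rel = Placement.unplaced R ax k′ eq

    label-old : (C : Completion j d lab) → ∀ c → placement (proj₁ (proj₁ C)) ≡ just c →
      Completion j (decide d e) (update lab e c)
    label-old ((R , isB) , k) c eq = (R , isB) , consistent-intro (Old.extend c R ax k′ (proj₁ rel) (proj₂ rel))
      where
      ax : IsTypeB (λ u v → u ~[ R ] v)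
      ax = typeB-elim R isB
      k′ : Consistent d lab R
      k′ = consistent-elim k
      rel : P ~[ R ] N ≡ same c (flip c) × (∀ y → T (d ∣ y ∣) → P ~[ R ] y ≡ same c (signed lab y))
      rel = Placement.placed R ax k′ c eq

    to-placed : (C : Completion j d lab) → ∀ w → placement (proj₁ (proj₁ C)) ≡ w → Target
    to-placed C nothing  eq = inj₁ (label-new C eq)
    to-placed C (just c) eq = inj₂ (c , label-old C c eq)

    to : Completion j d lab → Target
    to C = to-placed C _ refl

    from : Target → Completion j d lab
    from (inj₁ ((R , isB) , k))     = (R , isB) , consistent-intro (New.restrict R (consistent-elim k))
    from (inj₂ (c , (R , isB) , k)) = (R , isB) , consistent-intro (Old.restrict c R (consistent-elim k))

    from-to : ∀ C → from (to C) ≡ C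
    from-to C = from-to-placed _ refl
      where
      from-to-placed : ∀ w eq → from (to-placed C w eq) ≡ C
      from-to-placed nothing  _ = Completion-≡ refl
      from-to-placed (just _) _ = Completion-≡ refl

    to-from : ∀ t → to (from t) ≡ t
    to-from (inj₁ ((R , isB) , k)) = new-placed _ refl
      where
      new-placed : ∀ w eq → to-placed (from (inj₁ ((R , isB) , k))) w eq ≡ inj₁ ((R , isB) , k)
      new-placed nothing  _  = cong inj₁ (Completion-≡ refl)
      new-placed (just c) eq = nothing≢just (trans (sym (placement-new R (consistent-elim k))) eq)
    to-from (inj₂ (c , (R , isB) , k)) = old-placed _ refl
      where
      old-placed : ∀ w eq → to-placed (from (inj₂ (c , (R , isB) , k))) w eq ≡ inj₂ (c , (R , isB) , k)
      old-placed nothing   eq = nothing≢just (trans (sym eq) (placement-old R c (consistent-elim k)))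
      old-placed (just c′) eq with just-injective (trans (sym eq) (placement-old R c (consistent-elim k)))
      ... | refl = cong (λ C → inj₂ (c , C)) (Completion-≡ refl)

    completion-step : Completion j d lab ↔ Target
    completion-step = mk↔ₛ′ to from to-from from-to

    new-reps : Represents (suc j) (decide d e) New.lab′ (e Vector.∷ rep)
    new-reps zero    = decide-new d e , update-here (lift ∘ lab) e (block true zero)
    new-reps (suc t) = decide-old (proj₁ (reps t))
                     , trans (update-decided (lift ∘ lab) _ undecided-e (proj₁ (reps t))) (cong lift (proj₂ (reps t)))

    old-reps : ∀ c → Represents j (decide d e) (update lab e c) rep
    old-reps c t = decide-old (proj₁ (reps t)) , trans (update-decided lab c undecided-e (proj₁ (reps t))) (proj₂ (reps t))

  count-completions : ∀ r j d (lab : Fin n → Place j) rep → count (not ∘ d) ≡ r → Represents j d lab rep →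
    Completion j d lab ↔ Fin (extensions r j)
  count-completions zero    j d lab rep c reps = completion-total d lab (all-decided d c)
  count-completions (suc r) j d lab rep c reps = begin
      Completion j d lab
    ↔⟨ completion-step ⟩
      Target
    ↔⟨ count-completions r (suc j) (decide d e) New.lab′ (e Vector.∷ rep) c′ new-reps
       ⊎-↔ Σ-count places↔ (λ c → count-completions r j (decide d e) (update lab e c) rep c′ (old-reps c)) ⟩
      (Fin (extensions r (suc j)) ⊎ Fin (suc (j + j) * extensions r j))
    ↔⟨ ↔-sym +↔⊎ ⟩
      Fin (extensions (suc r) j) ∎
    where
    open Related.EquationalReasoning
    e : Fin n
    e = proj₁ (count-suc (not ∘ d) c)
    ne : T (not (d e))
    ne = proj₂ (count-suc (not ∘ d) c)
    open Step d lab rep e ne reps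
    c′ : count (not ∘ decide d e) ≡ r
    c′ = count-decide d e ne c

  -- Π_B(n) is the set of completions of the empty labelling.
  PiB↔ : PiB n ↔ Fin (extensions n 0)
  PiB↔ = ↔-trans as-completion (count-completions n 0 (λ _ → false) (λ _ → zeroBlock) (λ ()) (count-all n) (λ ()))
    where
    as-completion : PiB n ↔ Completion 0 (λ _ → false) (λ _ → zeroBlock)
    as-completion = mk↔ₛ′ (λ P → P , consistent-intro (λ _ _ ())) proj₁ (λ _ → Completion-≡ refl) (λ _ → refl)

corollary3p5 : (t : ℕ → ℕ) → ((m : ℕ) → Fin (t m) ↔ Involution m)
    → (n : ℕ) → n ≥ 1
    → Fin (sum1to n (λ k → S n k * t (suc k))) ↔ PiB n
corollary3p5 t H (suc n) (s≤s _) = begin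
    Fin (sum1to (suc n) (λ k → S (suc n) k * t (suc k)))
  ≡⟨ cong Fin (Σ<-cong (suc n) (λ k → cong (S (suc n) (suc k) *_) (counts-involutions t H (suc (suc k))))) ⟩
    Fin (sum1to (suc n) (λ k → S (suc n) k * involutions (suc k)))
  ≡⟨ cong Fin (stirling-involutions n) ⟩
    Fin (extensions (suc n) 0)
  ↔⟨ ↔-sym (TypeB.PiB↔ (suc n)) ⟩
    PiB (suc n) ∎
  where open Related.EquationalReasoning
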